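{- Let $S\subseteq[n]$. Then $S$ is independent if and only if, for every $\ell\in[k]$, the set $P^\ell\cap S$ is independent.
   Context: Let $p_1,\dots,p_n\in\{1,2,\dots\}$ be profits and $\gamma:2^{[n]}\to\mathbb Z_+$ a function with $\gamma(\emptyset)=0$ that is monotonically non-decreasing, submodular, and satisfies $\gamma(A\cup\{i\})-\gamma(A)\in\{0,p_i\}$ for all $i\in[n]$, $A\subseteq[n]$. A set $S\subseteq[n]$ is independent if $\gamma(S)=\sum_{i\in S}p_i$, dependent otherwise. The profit partition $(P^1,\dots,P^k)$ of $[n]$ is the partition into classes such that all items in $P^\ell$ have the same profit $p^\ell$, where $0<p^1<p^2<\dots<p^k$. -}

module Defs where

open import Data.Nat using (ℕ; zero; suc; _+_; _≤_; _≟_)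
open import Data.Bool using (Bool; true; false; if_then_else_)
open import Data.Fin using (Fin)
open import Data.Fin.Subset using (Subset; ⊥; _∪_; _∩_; _⊆_; ⁅_⁆)
open import Data.Vec using (Vec; []; _∷_; tabulate)
open import Data.Product using (_×_)
open import Data.Sum using (_⊎_)
open import Relation.Nullary.Decidable using (⌊_⌋)
open import Relation.Binary.PropositionalEquality using (_≡_)

profitSum : ∀ {n} → (Fin n → ℕ) → Subset n → ℕ
profitSum {zero}  p []          = 0
profitSum {suc n} p (true  ∷ S) = p Data.Fin.zero + profitSum (λ i → p (Data.Fin.suc i)) S
profitSum {suc n} p (false ∷ S) = profitSum (λ i → p (Data.Fin.suc i)) S

record IsProfitFunction {n : ℕ} (p : Fin n → ℕ) (γ : Subset n → ℕ) : Set where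
  field
    profit-pos   : ∀ i → 1 ≤ p i
    γ-empty      : γ ⊥ ≡ 0
    γ-monotone   : ∀ A B → A ⊆ B → γ A ≤ γ B
    γ-submodular : ∀ A B → γ (A ∪ B) + γ (A ∩ B) ≤ γ A + γ B
    γ-marginal   : ∀ i A → (γ (A ∪ ⁅ i ⁆) ≡ γ A) ⊎ (γ (A ∪ ⁅ i ⁆) ≡ γ A + p i)

Independent : ∀ {n} → (Fin n → ℕ) → (Subset n → ℕ) → Subset n → Set
Independent p γ S = γ S ≡ profitSum p S

-- The profit class of value v: { j | p j = v }.
-- The classes P^1,…,P^k of the profit partition are exactly profitClass p (p i), i ∈ [n].
profitClass : ∀ {n} → (Fin n → ℕ) → ℕ → Subset n
profitClass p v = tabulate (λ j → ⌊ p j ≟ v ⌋)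

{-# OPTIONS --safe #-}
module Submission where

-- Independence is inherited by subsets: for T ⊆ S submodularity gives
-- γ S ≤ γ T + γ (S ─ T), while γ never exceeds the (modular) profit sum.
-- Conversely, take S dependent with independent slices; by induction every S - x is
-- independent.  Re-adding x raises γ by 0 or by p x, and the latter would make S
-- independent, so γ S + p x = Σ_S p for every x ∈ S.  Thus all profits in S coincide,
-- S is one of its own slices, and so S is independent after all.

open import Defs
open import Data.Nat using (ℕ; zero; suc; _+_; _≤_; z≤n; _≟_)
open import Data.Nat.Properties using (≤-antisym; ≤-trans; ≤-reflexive; +-cancelˡ-≡; +-cancelʳ-≤; +-monoʳ-≤; +-mono-≤; +-identityʳ; +-assoc; +-comm; m≤m+n; +-commutativeSemigroup; module ≤-Reasoning)
open import Algebra.Properties.CommutativeSemigroup +-commutativeSemigroup using (interchange; x∙yz≈y∙xz)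
open import Data.Nat.Induction using (<-wellFounded)
open import Data.Bool using (true; false)
open import Data.Fin using (Fin)
open import Data.Fin.Subset using (Subset; _∈_; _⊆_; _⊂_; _∩_; _∪_; _─_; _-_; ⊥; ⁅_⁆; ∣_∣)
open import Data.Fin.Subset.Properties using (_∈?_; nonempty?; Empty-unique; ⊆-antisym; p⊂q⇒∣p∣<∣q∣; x∈p⇒p-x⊂p; p∩q⊆q; x∈p∩q⁺; x∈p∩q⁻; x∈p∪q⁺; x∈p∪q⁻; p─q⊆p; x∈p∧x∉q⇒x∈p─q; x∈⁅y⁆⇒x≡y; ∪-comm; ∪-identityˡ)
open import Data.Vec using ([]; _∷_)
open import Data.Vec.Properties using (lookup∘tabulate; lookup⇒[]=)
open import Data.Product using (_×_; _,_)
open import Data.Sum using (_⊎_; inj₁; inj₂; [_,_]; fromInj₂)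
open import Function using (_∘_)
open import Induction.WellFounded using (WellFounded; module Subrelation; module All)
open import Relation.Binary.Construct.On as On using ()
open import Relation.Nullary using (¬_; yes; no; contradiction)
open import Relation.Nullary.Decidable using (dec-true; isYes≗does)
open import Relation.Binary.PropositionalEquality using (_≡_; refl; sym; trans; cong; cong₂; subst; subst₂; module ≡-Reasoning)

private
  variable
    n : ℕ

⊂-wellFounded : WellFounded (_⊂_ {n})
⊂-wellFounded = Subrelation.wellFounded p⊂q⇒∣p∣<∣q∣ (On.wellFounded ∣_∣ <-wellFounded)

∩-monoʳ-⊆ : (C : Subset n) {A B : Subset n} → A ⊆ B → C ∩ A ⊆ C ∩ B
∩-monoʳ-⊆ C {A} A⊆B x∈C∩A with x∈p∩q⁻ C A x∈C∩A
... | x∈C , x∈A = x∈p∩q⁺ (x∈C , A⊆B x∈A)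

p⊆q⇒q∩p≡p : {A C : Subset n} → A ⊆ C → C ∩ A ≡ A
p⊆q⇒q∩p≡p {A = A} {C} A⊆C = ⊆-antisym (p∩q⊆q C A) (λ x∈A → x∈p∩q⁺ (A⊆C x∈A , x∈A))

p⊆q⇒p∪[q─p]≡q : {T S : Subset n} → T ⊆ S → T ∪ (S ─ T) ≡ S
p⊆q⇒p∪[q─p]≡q {T = T} {S} T⊆S = ⊆-antisym (⊆S ∘ x∈p∪q⁻ T (S ─ T)) S⊆
  where
  ⊆S : ∀ {x} → x ∈ T ⊎ x ∈ S ─ T → x ∈ S
  ⊆S = [ T⊆S , p─q⊆p S T ]
  S⊆ : S ⊆ T ∪ (S ─ T)
  S⊆ {x} x∈S with x ∈? T
  ... | yes x∈T = x∈p∪q⁺ (inj₁ x∈T)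
  ... | no  x∉T = x∈p∪q⁺ (inj₂ (x∈p∧x∉q⇒x∈p─q x∈S x∉T))

p∩[q─p]≡⊥ : (T S : Subset n) → T ∩ (S ─ T) ≡ ⊥
p∩[q─p]≡⊥ []          []      = refl
p∩[q─p]≡⊥ (true  ∷ T) (_ ∷ S) = cong (false ∷_) (p∩[q─p]≡⊥ T S)
p∩[q─p]≡⊥ (false ∷ T) (_ ∷ S) = cong (false ∷_) (p∩[q─p]≡⊥ T S)

x∈p⇒⁅x⁆⊆p : {x : Fin n} {S : Subset n} → x ∈ S → ⁅ x ⁆ ⊆ S
x∈p⇒⁅x⁆⊆p {x = x} x∈S y∈⁅x⁆ = subst (_∈ _) (sym (x∈⁅y⁆⇒x≡y x y∈⁅x⁆)) x∈S

x∈p⇒p-x∪⁅x⁆≡p : {x : Fin n} {S : Subset n} → x ∈ S → (S - x) ∪ ⁅ x ⁆ ≡ S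
x∈p⇒p-x∪⁅x⁆≡p {x = x} {S} x∈S = trans (∪-comm (S - x) ⁅ x ⁆) (p⊆q⇒p∪[q─p]≡q (x∈p⇒⁅x⁆⊆p x∈S))

∈-profitClass : (p : Fin n → ℕ) {v : ℕ} {x : Fin n} → p x ≡ v → x ∈ profitClass p v
∈-profitClass p {v} {x} px≡v =
  lookup⇒[]= x _ (trans (lookup∘tabulate _ x) (trans (isYes≗does (p x ≟ v)) (dec-true (p x ≟ v) px≡v)))

profitSum-⊥ : (p : Fin n → ℕ) → profitSum p ⊥ ≡ 0
profitSum-⊥ {zero}  p = refl
profitSum-⊥ {suc n} p = profitSum-⊥ (p ∘ Fin.suc)

profitSum-⁅⁆ : (p : Fin n → ℕ) (x : Fin n) → profitSum p ⁅ x ⁆ ≡ p x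
profitSum-⁅⁆ p Fin.zero    = trans (cong (p Fin.zero +_) (profitSum-⊥ (p ∘ Fin.suc))) (+-identityʳ _)
profitSum-⁅⁆ p (Fin.suc x) = profitSum-⁅⁆ (p ∘ Fin.suc) x

profitSum-modular : (p : Fin n → ℕ) (A B : Subset n) →
                    profitSum p (A ∪ B) + profitSum p (A ∩ B) ≡ profitSum p A + profitSum p B
profitSum-modular p []      []      = refl
profitSum-modular p (x ∷ A) (y ∷ B) = cons x y
  where
  a : ℕ
  a = p Fin.zero
  σ : Subset _ → ℕ
  σ = profitSum (p ∘ Fin.suc)
  ih : σ (A ∪ B) + σ (A ∩ B) ≡ σ A + σ B
  ih = profitSum-modular (p ∘ Fin.suc) A B
  cons : ∀ x y → profitSum p ((x ∷ A) ∪ (y ∷ B)) + profitSum p ((x ∷ A) ∩ (y ∷ B))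
                 ≡ profitSum p (x ∷ A) + profitSum p (y ∷ B)
  cons true  true  = trans (interchange a (σ (A ∪ B)) a (σ (A ∩ B)))
                       (trans (cong (a + a +_) ih) (interchange a a (σ A) (σ B)))
  cons true  false = trans (+-assoc a (σ (A ∪ B)) (σ (A ∩ B)))
                       (trans (cong (a +_) ih) (sym (+-assoc a (σ A) (σ B))))
  cons false true  = trans (+-assoc a (σ (A ∪ B)) (σ (A ∩ B)))
                       (trans (cong (a +_) ih) (x∙yz≈y∙xz a (σ A) (σ B)))
  cons false false = ih

profitSum-split : (p : Fin n → ℕ) {T S : Subset n} → T ⊆ S →
                  profitSum p S ≡ profitSum p T + profitSum p (S ─ T)
profitSum-split p {T} {S} T⊆S = begin
  profitSum p S                                             ≡⟨ +-identityʳ _ ⟨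
  profitSum p S + 0                                         ≡⟨ cong₂ _+_ (cong (profitSum p) (p⊆q⇒p∪[q─p]≡q T⊆S)) disjoint ⟨
  profitSum p (T ∪ (S ─ T)) + profitSum p (T ∩ (S ─ T))     ≡⟨ profitSum-modular p T (S ─ T) ⟩
  profitSum p T + profitSum p (S ─ T)                       ∎
  where
  open ≡-Reasoning
  disjoint : profitSum p (T ∩ (S ─ T)) ≡ 0
  disjoint = trans (cong (profitSum p) (p∩[q─p]≡⊥ T S)) (profitSum-⊥ p)

profitSum-remove : (p : Fin n → ℕ) {x : Fin n} {S : Subset n} → x ∈ S →
                   profitSum p S ≡ p x + profitSum p (S - x)
profitSum-remove p {x} {S} x∈S =
  trans (profitSum-split p (x∈p⇒⁅x⁆⊆p x∈S)) (cong (_+ profitSum p (S - x)) (profitSum-⁅⁆ p x))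

module ProfitFunction {p : Fin n → ℕ} {γ : Subset n → ℕ} (isPF : IsProfitFunction p γ) where
  open IsProfitFunction isPF

  independent-⊥ : Independent p γ ⊥
  independent-⊥ = trans γ-empty (sym (profitSum-⊥ p))

  γ-∪⁅⁆≤ : (A : Subset n) (x : Fin n) → γ (A ∪ ⁅ x ⁆) ≤ γ A + p x
  γ-∪⁅⁆≤ A x = [ (λ e → ≤-trans (≤-reflexive e) (m≤m+n (γ A) (p x))) , ≤-reflexive ] (γ-marginal x A)

  γ-⁅⁆≤ : (x : Fin n) → γ ⁅ x ⁆ ≤ p x
  γ-⁅⁆≤ x = subst₂ _≤_ (cong γ (∪-identityˡ ⁅ x ⁆)) (cong (_+ p x) γ-empty) (γ-∪⁅⁆≤ ⊥ x)

  γ-split≤ : {T S : Subset n} → T ⊆ S → γ S ≤ γ T + γ (S ─ T)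
  γ-split≤ {T} {S} T⊆S = begin
    γ S                                   ≡⟨ +-identityʳ (γ S) ⟨
    γ S + 0                               ≡⟨ cong₂ _+_ (cong γ (p⊆q⇒p∪[q─p]≡q T⊆S)) disjoint ⟨
    γ (T ∪ (S ─ T)) + γ (T ∩ (S ─ T))     ≤⟨ γ-submodular T (S ─ T) ⟩
    γ T + γ (S ─ T)                       ∎
    where
    open ≤-Reasoning
    disjoint : γ (T ∩ (S ─ T)) ≡ 0
    disjoint = trans (cong γ (p∩[q─p]≡⊥ T S)) γ-empty

  γ≤profitSum : (S : Subset n) → γ S ≤ profitSum p S
  γ≤profitSum = All.wfRec ⊂-wellFounded _ (λ S → γ S ≤ profitSum p S) step
    where
    step : (S : Subset n) → (∀ {T} → T ⊂ S → γ T ≤ profitSum p T) → γ S ≤ profitSum p S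
    step S below with nonempty? S
    ... | no  S-empty    = ≤-trans (≤-reflexive (trans (cong γ (Empty-unique S-empty)) γ-empty)) z≤n
    ... | yes (x , x∈S) = begin
      γ S                        ≤⟨ γ-split≤ (x∈p⇒⁅x⁆⊆p x∈S) ⟩
      γ ⁅ x ⁆ + γ (S - x)        ≤⟨ +-mono-≤ (γ-⁅⁆≤ x) (below (x∈p⇒p-x⊂p x∈S)) ⟩
      p x + profitSum p (S - x)  ≡⟨ profitSum-remove p x∈S ⟨
      profitSum p S              ∎
      where open ≤-Reasoning

  independent-⊆ : {T S : Subset n} → T ⊆ S → Independent p γ S → Independent p γ T
  independent-⊆ {T} {S} T⊆S S-indep = ≤-antisym (γ≤profitSum T) (+-cancelʳ-≤ (profitSum p (S ─ T)) _ _ (begin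
    profitSum p T + profitSum p (S ─ T)   ≡⟨ profitSum-split p T⊆S ⟨
    profitSum p S                         ≡⟨ S-indep ⟨
    γ S                                   ≤⟨ γ-split≤ T⊆S ⟩
    γ T + γ (S ─ T)                       ≤⟨ +-monoʳ-≤ (γ T) (γ≤profitSum (S ─ T)) ⟩
    γ T + profitSum p (S ─ T)             ∎))
    where open ≤-Reasoning

  independent-or-deficit : {x : Fin n} {S : Subset n} → x ∈ S → Independent p γ (S - x) →
                           Independent p γ S ⊎ γ S + p x ≡ profitSum p S
  independent-or-deficit {x} {S} x∈S S-x-indep =
    [ inj₂ ∘ unchanged⇒deficit , inj₁ ∘ increased⇒independent ] (γ-marginal x (S - x))
    where
    open ≡-Reasoning
    S-x+x≡S : γ ((S - x) ∪ ⁅ x ⁆) ≡ γ S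
    S-x+x≡S = cong γ (x∈p⇒p-x∪⁅x⁆≡p x∈S)
    removed+px≡ : profitSum p (S - x) + p x ≡ profitSum p S
    removed+px≡ = trans (+-comm _ (p x)) (sym (profitSum-remove p x∈S))
    unchanged⇒deficit : γ ((S - x) ∪ ⁅ x ⁆) ≡ γ (S - x) → γ S + p x ≡ profitSum p S
    unchanged⇒deficit e = begin
      γ S + p x                    ≡⟨ cong (_+ p x) S-x+x≡S ⟨
      γ ((S - x) ∪ ⁅ x ⁆) + p x    ≡⟨ cong (_+ p x) (trans e S-x-indep) ⟩
      profitSum p (S - x) + p x    ≡⟨ removed+px≡ ⟩
      profitSum p S                ∎
    increased⇒independent : γ ((S - x) ∪ ⁅ x ⁆) ≡ γ (S - x) + p x → Independent p γ S
    increased⇒independent e = begin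
      γ S                          ≡⟨ S-x+x≡S ⟨
      γ ((S - x) ∪ ⁅ x ⁆)          ≡⟨ trans e (cong (_+ p x) S-x-indep) ⟩
      profitSum p (S - x) + p x    ≡⟨ removed+px≡ ⟩
      profitSum p S                ∎

  minimally-dependent⇒equal-profits : {S : Subset n} → ¬ Independent p γ S →
    (∀ {x} → x ∈ S → Independent p γ (S - x)) → ∀ {x y} → x ∈ S → y ∈ S → p x ≡ p y
  minimally-dependent⇒equal-profits {S} S-dep minus-indep x∈S y∈S =
    +-cancelˡ-≡ (γ S) _ _ (trans (deficit x∈S) (sym (deficit y∈S)))
    where
    deficit : ∀ {z} → z ∈ S → γ S + p z ≡ profitSum p S
    deficit z∈S = fromInj₂ (λ S-indep → contradiction S-indep S-dep) (independent-or-deficit z∈S (minus-indep z∈S))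

  slices-independent⇒independent : (S : Subset n) →
    (∀ i → Independent p γ (profitClass p (p i) ∩ S)) → Independent p γ S
  slices-independent⇒independent = All.wfRec ⊂-wellFounded _ SlicesInd⇒Ind step
    where
    SlicesInd⇒Ind : Subset n → Set
    SlicesInd⇒Ind S = (∀ i → Independent p γ (profitClass p (p i) ∩ S)) → Independent p γ S
    step : (S : Subset n) → (∀ {T} → T ⊂ S → SlicesInd⇒Ind T) → SlicesInd⇒Ind S
    step S below slices with nonempty? S
    ... | no S-empty = subst (Independent p γ) (sym (Empty-unique S-empty)) independent-⊥
    ... | yes (j , j∈S) with γ S ≟ profitSum p S
    ...   | yes S-indep = S-indep
    ...   | no  S-dep   = subst (Independent p γ) (p⊆q⇒q∩p≡p S⊆Pj) (slices j)
      where
      minus-indep : ∀ {x} → x ∈ S → Independent p γ (S - x)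
      minus-indep {x} x∈S = below (x∈p⇒p-x⊂p x∈S)
        (λ i → independent-⊆ (∩-monoʳ-⊆ (profitClass p (p i)) (p─q⊆p S ⁅ x ⁆)) (slices i))
      S⊆Pj : S ⊆ profitClass p (p j)
      S⊆Pj x∈S = ∈-profitClass p (minimally-dependent⇒equal-profits S-dep minus-indep x∈S j∈S)

lemma3 : ∀ {n : ℕ} (p : Fin n → ℕ) (γ : Subset n → ℕ) → IsProfitFunction p γ → (S : Subset n) → (Independent p γ S → ∀ (i : Fin n) → Independent p γ (profitClass p (p i) ∩ S)) × ((∀ (i : Fin n) → Independent p γ (profitClass p (p i) ∩ S)) → Independent p γ S)
lemma3 p γ isPF S =
  (λ S-indep i → independent-⊆ (p∩q⊆q (profitClass p (p i)) S) S-indep) , slices-independent⇒independent S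
  where open ProfitFunction isPF
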